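{- For an integer $n\ge 2$, let $a_n:=\prod_{k=2}^n(k^2-1)$. Then $a_n$ is a perfect square if and only if $2n(n+1)$ is a perfect square.
   Context: A perfect square means the square of an integer. -}

module Defs where

open import Data.Nat using (ℕ; zero; suc; _*_; _∸_; _^_)
open import Data.Product using (∃-syntax)
open import Relation.Binary.PropositionalEquality using (_≡_)

a : ℕ → ℕ
a zero = 1
a (suc zero) = 1
a (suc (suc n)) = a (suc n) * ((suc (suc n)) ^ 2 ∸ 1)

-- A natural number is a perfect square if it is the square of an integer;
-- for a nonnegative value this is equivalent to being the square of a natural
-- (m^2 = |m|^2), so we quantify over ℕ.
IsPerfectSquare : ℕ → Set
IsPerfectSquare x = ∃[ m ] (m * m ≡ x)

-- Telescoping the factors k² − 1 = (k − 1)(k + 1) gives a n · 2n = (n!)² (n + 1), hence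
-- a n · (2n)² = 2n(n + 1) · (n!)².  Two numbers that agree up to nonzero square factors are
-- squares together, because c² ∣ m² forces c ∣ m.
module Submission where

open import Defs
open import Data.Nat using (ℕ; _≤_; _*_; _+_)
open import Function.Bundles using (_⇔_)

open import Data.Nat using (zero; suc; _∸_; _^_; NonZero; _/_; _!; ≢-nonZero)
open import Data.Nat.Properties using (*-cancelʳ-≡; *-identityˡ; m*n≢0; _!≢0)
open import Data.Nat.Divisibility
  using (_∣_; divides; ∣-refl; ∣-trans; m∣m*n; *-cancelʳ-∣)
open import Data.Nat.DivMod using (m/n*n≡m)
open import Data.Nat.GCD using (gcd; gcd[m,n]∣m; gcd[m,n]∣n; gcd[m,n]≢0)
open import Data.Nat.Coprimality using (coprime-/gcd; coprime-divisor)
open import Data.Nat.Tactic.RingSolver using (solve-∀)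
open import Data.Product using (_,_)
open import Data.Sum using (inj₁)
open import Function.Bundles using (mk⇔)
open import Relation.Binary.PropositionalEquality
  using (_≡_; refl; sym; trans; cong; subst; subst₂; module ≡-Reasoning)

*-square-distrib : ∀ p q → (p * q) * (p * q) ≡ (p * p) * (q * q)
*-square-distrib = solve-∀

square∣square⇒∣ : ∀ {c m} .{{_ : NonZero c}} → c * c ∣ m * m → c ∣ m
square∣square⇒∣ {c@(suc _)} {m} c²∣m² = subst (_∣ m) g≡c (gcd[m,n]∣n c m)
  where
  g = gcd c m
  instance
    g≢0 : NonZero g
    g≢0 = ≢-nonZero (gcd[m,n]≢0 c m (inj₁ (λ ())))
    g²≢0 : NonZero (g * g)
    g²≢0 = m*n≢0 g g
  c′ = c / g
  m′ = m / g
  c′g≡c : c′ * g ≡ c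
  c′g≡c = m/n*n≡m (gcd[m,n]∣m c m)
  square-reduced : ∀ {x} → x / g * g ≡ x → x * x ≡ (x / g) * (x / g) * (g * g)
  square-reduced {x} e = trans (cong (λ y → y * y) (sym e)) (*-square-distrib (x / g) g)
  c′²∣m′² : c′ * c′ ∣ m′ * m′
  c′²∣m′² = *-cancelʳ-∣ (g * g)
    (subst₂ _∣_ (square-reduced c′g≡c) (square-reduced (m/n*n≡m (gcd[m,n]∣n c m))) c²∣m²)
  -- c′ and m′ are coprime, so c′ ∣ m′ · m′ gives c′ ∣ m′, and then c′ = 1.
  c′≡1 : c′ ≡ 1
  c′≡1 = coprime-/gcd c m
           (∣-refl , coprime-divisor (coprime-/gcd c m) (∣-trans (m∣m*n c′) c′²∣m′²))
  g≡c : g ≡ c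
  g≡c = trans (sym (*-identityˡ g)) (trans (cong (_* g) (sym c′≡1)) c′g≡c)

square-*-cancelʳ : ∀ x c .{{_ : NonZero c}} → IsPerfectSquare (x * (c * c)) → IsPerfectSquare x
square-*-cancelʳ x c (m , m²≡xc²) with square∣square⇒∣ {c} {m} (divides x m²≡xc²)
... | divides q refl =
  q , *-cancelʳ-≡ (q * q) x (c * c) {{m*n≢0 c c}} (trans (sym (*-square-distrib q c)) m²≡xc²)

square-* : ∀ {x y} → IsPerfectSquare x → IsPerfectSquare y → IsPerfectSquare (x * y)
square-* (m , refl) (k , refl) = m * k , *-square-distrib m k

square-⇔-up-to-squares : ∀ x y c d .{{_ : NonZero c}} .{{_ : NonZero d}} →
                         x * (c * c) ≡ y * (d * d) →
                         IsPerfectSquare x ⇔ IsPerfectSquare y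
square-⇔-up-to-squares x y c d xc²≡yd² = mk⇔
  (λ sq-x → square-*-cancelʳ y d (subst IsPerfectSquare xc²≡yd² (square-* sq-x (c , refl))))
  (λ sq-y → square-*-cancelʳ x c (subst IsPerfectSquare (sym xc²≡yd²) (square-* sq-y (d , refl))))

a-telescopes : ∀ k → a (suc k) * (2 * suc k) ≡ suc k ! * suc k ! * (suc k + 1)
a-telescopes zero = refl
a-telescopes (suc k) =
  begin
    a (suc k) * (suc (suc k) ^ 2 ∸ 1) * (2 * suc (suc k))
  ≡⟨ cong (λ z → a (suc k) * z * (2 * suc (suc k))) (square-pred k) ⟩
    a (suc k) * (suc k * (k + 3)) * (2 * suc (suc k))
  ≡⟨ regroup (a (suc k)) k ⟩
    a (suc k) * (2 * suc k) * (suc (suc k) * (k + 3))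
  ≡⟨ cong (_* (suc (suc k) * (k + 3))) (a-telescopes k) ⟩
    suc k ! * suc k ! * (suc k + 1) * (suc (suc k) * (k + 3))
  ≡⟨ absorb (suc k !) k ⟩
    suc (suc k) ! * suc (suc k) ! * (suc (suc k) + 1)
  ∎
  where
  open ≡-Reasoning
  -- The left side is the normal form of (k + 2)² ∸ 1, which the solver cannot handle.
  square-pred : ∀ k → suc (suc k) ^ 2 ∸ 1 ≡ suc k * (k + 3)
  square-pred k = sq k
    where
    sq : ∀ k → suc k * 1 + suc k * (suc (suc k) * 1) ≡ suc k * (k + 3)
    sq = solve-∀
  regroup : ∀ A k → A * (suc k * (k + 3)) * (2 * suc (suc k))
                  ≡ A * (2 * suc k) * (suc (suc k) * (k + 3))
  regroup = solve-∀
  absorb : ∀ F k → F * F * (suc k + 1) * (suc (suc k) * (k + 3))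
                 ≡ (suc (suc k) * F) * (suc (suc k) * F) * (suc (suc k) + 1)
  absorb = solve-∀

a-scaled : ∀ k → a (suc k) * (2 * suc k * (2 * suc k))
               ≡ 2 * suc k * (suc k + 1) * (suc k ! * suc k !)
a-scaled k = trans (reassoc (a (suc k)) (2 * suc k))
                   (trans (cong (_* (2 * suc k)) (a-telescopes k))
                          (swap (suc k !) (suc k)))
  where
  reassoc : ∀ A B → A * (B * B) ≡ A * B * B
  reassoc = solve-∀
  swap : ∀ F N → F * F * (N + 1) * (2 * N) ≡ 2 * N * (N + 1) * (F * F)
  swap = solve-∀

lemma2p1 : (n : ℕ) → 2 ≤ n → (IsPerfectSquare (a n) ⇔ IsPerfectSquare (2 * n * (n + 1)))
lemma2p1 (suc k) _ =
  square-⇔-up-to-squares (a (suc k)) (2 * suc k * (suc k + 1)) (2 * suc k) (suc k !)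
    {{_}} {{suc k !≢0}} (a-scaled k)
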